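{- For all $n,m\in\mathbb{N}$, $\mathrm{Obj}(\mathcal{P}_{\mathrm{FR\text{ - }MFLP}}(m))\le\mathrm{Obj}(\mathcal{P}_{\mathrm{SFR\text{ - }MFLP}}(n))$.
   Context: $x^+=\max\{x,0\}$, $[x:y]=\{x,\dots,y\}$, $\mathrm{Obj}(\cdot)$ is the optimal (supremum) value. $\mathcal{P}_{\mathrm{FR\text{ - }MFLP}}(m)$: maximize $\sum_{\ell\in[m]}\alpha(\ell)$ over $f\ge0$, $\alpha(\ell),\delta(\ell)\ge0$ ($\ell\in[m]$) subject to: $\alpha(\ell)\le\alpha(\ell')$ for all $\ell\le\ell'$ in $[m]$; $\alpha(\ell')\le\alpha(\ell)+\delta(\ell)+\delta(\ell')$ for all $\ell,\ell'\in[m]$; $\sum_{\ell'\in[\ell:m]}(\alpha(\ell)-\delta(\ell'))^+\le f$ for each $\ell\in[m]$; $f+\sum_{\ell\in[m]}\delta(\ell)\le1$. $\mathcal{P}_{\mathrm{SFR\text{ - }MFLP}}(n)$: maximize $\sum_{\ell\in[n]}\alpha(\ell)$ over $f\ge0$, $\alpha(\ell),\delta(\ell)\ge0$ ($\ell\in[n]$) subject to: $\alpha(\ell)\le\alpha(\ell')$ for all $\ell\le\ell'$ in $[n]$; $\alpha(\ell')\le\alpha(\ell)+\delta(\ell)+\delta(\ell')$ for all $\ell,\ell'\in[2:n]$; $\sum_{\ell'\in[\ell+1:n]}(\alpha(\ell)-\delta(\ell'))^+\le f$ for each $\ell\in[n]$; $f+\sum_{\ell\in[n]}\delta(\ell)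\le1$.
   Formalization: The variables f, α(ℓ) and δ(ℓ) of both programs take only rational values. -}

module Defs where

open import Data.Nat as ℕ using (ℕ; zero; suc; _∸_)
open import Data.Rational using (ℚ; 0ℚ; 1ℚ; _+_; _-_; _≤_; _<_; _⊔_)
open import Data.Product using (_×_)

_⁺ : ℚ → ℚ
x ⁺ = x ⊔ 0ℚ

sumN : ℕ → ℕ → (ℕ → ℚ) → ℚ
sumN a zero    g = 0ℚ
sumN a (suc k) g = g a + sumN (suc a) k g

-- Σ over the integer range [a:b] = {a,...,b} (empty if b < a)
Σ[_∶_] : ℕ → ℕ → (ℕ → ℚ) → ℚ
Σ[ a ∶ b ] g = sumN a (suc b ∸ a) g

_∈[_∶_] : ℕ → ℕ → ℕ → Set
ℓ ∈[ a ∶ b ] = (a ℕ.≤ ℓ) × (ℓ ℕ.≤ b)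

-- Feasible points of P_FR-MFLP(m); variables α, δ indexed by ℓ ∈ [1:m]
-- (values outside [1:m] are irrelevant).
record FRFeasible (m : ℕ) (f : ℚ) (α δ : ℕ → ℚ) : Set where
  field
    f≥0    : 0ℚ ≤ f
    α≥0    : ∀ ℓ → ℓ ∈[ 1 ∶ m ] → 0ℚ ≤ α ℓ
    δ≥0    : ∀ ℓ → ℓ ∈[ 1 ∶ m ] → 0ℚ ≤ δ ℓ
    mono   : ∀ ℓ ℓ' → ℓ ∈[ 1 ∶ m ] → ℓ' ∈[ 1 ∶ m ] → ℓ ℕ.≤ ℓ' → α ℓ ≤ α ℓ'
    metric : ∀ ℓ ℓ' → ℓ ∈[ 1 ∶ m ] → ℓ' ∈[ 1 ∶ m ] → α ℓ' ≤ α ℓ + δ ℓ + δ ℓ'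
    facility : ∀ ℓ → ℓ ∈[ 1 ∶ m ] → Σ[ ℓ ∶ m ] (λ ℓ' → (α ℓ - δ ℓ') ⁺) ≤ f
    budget : f + Σ[ 1 ∶ m ] δ ≤ 1ℚ

record SFRFeasible (n : ℕ) (f : ℚ) (α δ : ℕ → ℚ) : Set where
  field
    f≥0    : 0ℚ ≤ f
    α≥0    : ∀ ℓ → ℓ ∈[ 1 ∶ n ] → 0ℚ ≤ α ℓ
    δ≥0    : ∀ ℓ → ℓ ∈[ 1 ∶ n ] → 0ℚ ≤ δ ℓ
    mono   : ∀ ℓ ℓ' → ℓ ∈[ 1 ∶ n ] → ℓ' ∈[ 1 ∶ n ] → ℓ ℕ.≤ ℓ' → α ℓ ≤ α ℓ'
    metric : ∀ ℓ ℓ' → ℓ ∈[ 2 ∶ n ] → ℓ' ∈[ 2 ∶ n ] → α ℓ' ≤ α ℓ + δ ℓ + δ ℓ'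
    facility : ∀ ℓ → ℓ ∈[ 1 ∶ n ] → Σ[ suc ℓ ∶ n ] (λ ℓ' → (α ℓ - δ ℓ') ⁺) ≤ f
    budget : f + Σ[ 1 ∶ n ] δ ≤ 1ℚ

-- Obj(P_FR-MFLP(m)) ≤ Obj(P_SFR-MFLP(n)) as an inequality of suprema:
-- every feasible objective value of the first is approximated within any
-- ε > 0 by a feasible objective value of the second.
ObjFR≤ObjSFR : ℕ → ℕ → Set
ObjFR≤ObjSFR m n =
  ∀ (f : ℚ) (α δ : ℕ → ℚ) → FRFeasible m f α δ →
  ∀ (ε : ℚ) → 0ℚ < ε →
  Σ ℚ λ f' → Σ (ℕ → ℚ) λ α' → Σ (ℕ → ℚ) λ δ' →
    SFRFeasible n f' α' δ' × (Σ[ 1 ∶ m ] α - ε < Σ[ 1 ∶ n ] α')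
  where open import Data.Product using (Σ)

{-# OPTIONS --safe #-}
module Submission where

-- Cut each of the m clients of a feasible FR point into n atoms of weight 1/n, list the n·m atoms
-- client by client, and let the j-th SFR client be the j-th run of m consecutive atoms, carrying
-- the weighted sums of α and δ over its atoms. This preserves Σα (so no ε-slack is needed) and Σδ,
-- and the monotonicity and metric constraints hold atom by atom. For the facility constraint of
-- block j: if client q+1 owns the last atom of block j, every atom of block j has α ≤ α(q+1), and
-- the atoms of all later blocks belong to clients in [q+1 : m], so their contribution is at most
-- the FR facility sum of client q+1.

open import Defs
open import Data.Nat using (ℕ; _≤_)
open import Data.Nat as ℕ using (zero; suc; _∸_; z≤n; s≤s)
import Data.Nat.Properties as ℕₚ
open import Data.Nat.DivMod using (m*n/n≡m; m/n*n≤m; /-monoˡ-≤; m<n*o⇒m/o<n)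
open import Data.Rational
  using (ℚ; 0ℚ; 1ℚ; _+_; _-_; _*_; -_; _⊔_; 1/_; Positive; NonNegative; nonNegative)
  renaming (_≤_ to _≤ℚ_; _<_ to _<ℚ_)
import Data.Rational.Properties as ℚₚ
open import Algebra.Bundles using (CommutativeMonoid)
open import Algebra.Properties.CommutativeSemigroup
  (CommutativeMonoid.commutativeSemigroup ℚₚ.+-0-commutativeMonoid) using (interchange)
open import Data.Product using (_×_; _,_; proj₂)
open import Relation.Binary.PropositionalEquality

InRange : ℕ → ℕ → ℕ → Set
InRange s k t = s ≤ t × t ℕ.< s ℕ.+ k

inRange-head : ∀ s k → InRange s (suc k) s
inRange-head s k = ℕₚ.≤-refl , subst (s ℕ.<_) (sym (ℕₚ.+-suc s k)) (s≤s (ℕₚ.m≤m+n s k))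

inRange-tail : ∀ {s k t} → InRange (suc s) k t → InRange s (suc k) t
inRange-tail {s} {k} {t} (s<t , t<) = ℕₚ.<⇒≤ s<t , subst (t ℕ.<_) (sym (ℕₚ.+-suc s k)) t<

sumN-pointwise : (R : ℚ → ℚ → Set) → R 0ℚ 0ℚ →
                 (∀ {a b c d} → R a b → R c d → R (a + c) (b + d)) →
                 ∀ s k {g h} → (∀ t → InRange s k t → R (g t) (h t)) → R (sumN s k g) (sumN s k h)
sumN-pointwise R R0 R+ s zero    gRh = R0
sumN-pointwise R R0 R+ s (suc k) gRh =
  R+ (gRh s (inRange-head s k)) (sumN-pointwise R R0 R+ (suc s) k (λ t r → gRh t (inRange-tail r)))

sumN-cong : ∀ s k {g h} → (∀ t → InRange s k t → g t ≡ h t) → sumN s k g ≡ sumN s k h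
sumN-cong = sumN-pointwise _≡_ refl (cong₂ _+_)

sumN-mono : ∀ s k {g h} → (∀ t → InRange s k t → g t ≤ℚ h t) → sumN s k g ≤ℚ sumN s k h
sumN-mono = sumN-pointwise _≤ℚ_ ℚₚ.≤-refl ℚₚ.+-mono-≤

sumN-nonneg : ∀ s k {g} → (∀ t → InRange s k t → 0ℚ ≤ℚ g t) → 0ℚ ≤ℚ sumN s k g
sumN-nonneg s k {g} = sumN-pointwise (λ x _ → 0ℚ ≤ℚ x) ℚₚ.≤-refl ℚₚ.+-mono-≤ s k {g} {g}

sumN-++ : ∀ a p q g → sumN a (p ℕ.+ q) g ≡ sumN a p g + sumN (a ℕ.+ p) q g
sumN-++ a zero    q g = sym (trans (ℚₚ.+-identityˡ _) (cong (λ b → sumN b q g) (ℕₚ.+-identityʳ a)))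
sumN-++ a (suc p) q g = begin
  g a + sumN (suc a) (p ℕ.+ q) g
    ≡⟨ cong (g a +_) (sumN-++ (suc a) p q g) ⟩
  g a + (sumN (suc a) p g + sumN (suc a ℕ.+ p) q g)
    ≡⟨ sym (ℚₚ.+-assoc (g a) _ _) ⟩
  sumN a (suc p) g + sumN (suc a ℕ.+ p) q g
    ≡⟨ cong (λ b → sumN a (suc p) g + sumN b q g) (sym (ℕₚ.+-suc a p)) ⟩
  sumN a (suc p) g + sumN (a ℕ.+ suc p) q g ∎
  where open ≡-Reasoning

sumN-shift : ∀ b s k g → sumN (b ℕ.+ s) k g ≡ sumN s k (λ t → g (b ℕ.+ t))
sumN-shift b s zero    g = refl
sumN-shift b s (suc k) g =
  cong (g (b ℕ.+ s) +_) (trans (cong (λ x → sumN x k g) (sym (ℕₚ.+-suc b s))) (sumN-shift b (suc s) k g))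

sumN-from0 : ∀ b k g → sumN b k g ≡ sumN 0 k (λ t → g (b ℕ.+ t))
sumN-from0 b k g = trans (cong (λ x → sumN x k g) (sym (ℕₚ.+-identityʳ b))) (sumN-shift b 0 k g)

sumN-+ : ∀ s k g h → sumN s k (λ i → g i + h i) ≡ sumN s k g + sumN s k h
sumN-+ s zero    g h = refl
sumN-+ s (suc k) g h =
  trans (cong (g s + h s +_) (sumN-+ (suc s) k g h)) (interchange (g s) (h s) _ _)

sumN-neg : ∀ s k g → sumN s k (λ i → - g i) ≡ - sumN s k g
sumN-neg s zero    g = refl
sumN-neg s (suc k) g = trans (cong (- g s +_) (sumN-neg (suc s) k g)) (sym (ℚₚ.neg-distrib-+ (g s) _))

sumN-- : ∀ s k g h → sumN s k (λ i → g i - h i) ≡ sumN s k g - sumN s k h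
sumN-- s k g h = trans (sumN-+ s k g (λ i → - h i)) (cong (sumN s k g +_) (sumN-neg s k h))

sumN-const : ∀ s s' k y → sumN s k (λ _ → y) ≡ sumN s' k (λ _ → 1ℚ) * y
sumN-const s s' zero    y = sym (ℚₚ.*-zeroˡ y)
sumN-const s s' (suc k) y =
  trans (cong₂ _+_ (sym (ℚₚ.*-identityˡ y)) (sumN-const (suc s) (suc s') k y))
        (sym (ℚₚ.*-distribʳ-+ y 1ℚ (sumN (suc s') k (λ _ → 1ℚ))))

sumN-≤-extendˡ : ∀ {a b k k' g} → (∀ t → 0ℚ ≤ℚ g t) → a ≤ b → b ℕ.+ k ≡ a ℕ.+ k' →
                 sumN b k g ≤ℚ sumN a k' g
sumN-≤-extendˡ {a} {b} {k} {k'} {g} g≥0 a≤b b+k≡a+k' = begin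
  sumN b k g                   ≡⟨ cong (λ x → sumN x k g) (sym a+d≡b) ⟩
  sumN (a ℕ.+ d) k g           ≡⟨ sym (ℚₚ.+-identityˡ _) ⟩
  0ℚ + sumN (a ℕ.+ d) k g      ≤⟨ ℚₚ.+-monoˡ-≤ _ (sumN-nonneg a d (λ t _ → g≥0 t)) ⟩
  sumN a d g + sumN (a ℕ.+ d) k g ≡⟨ sym (sumN-++ a d k g) ⟩
  sumN a (d ℕ.+ k) g           ≡⟨ cong (λ x → sumN a x g) d+k≡k' ⟩
  sumN a k' g                  ∎
  where
  open ℚₚ.≤-Reasoning
  d : ℕ
  d = b ∸ a
  a+d≡b : a ℕ.+ d ≡ b
  a+d≡b = ℕₚ.m+[n∸m]≡n a≤b
  d+k≡k' : d ℕ.+ k ≡ k'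
  d+k≡k' = ℕₚ.+-cancelˡ-≡ a _ _
    (trans (sym (ℕₚ.+-assoc a d k)) (trans (cong (ℕ._+ k) a+d≡b) b+k≡a+k'))

sumN-blocks : ∀ s h a k →
              sumN (a ℕ.* s) (k ℕ.* s) h ≡ sumN (suc a) k (λ j → sumN ((j ∸ 1) ℕ.* s) s h)
sumN-blocks s h a zero    = refl
sumN-blocks s h a (suc k) = begin
  sumN (a ℕ.* s) (s ℕ.+ k ℕ.* s) h
    ≡⟨ sumN-++ (a ℕ.* s) s (k ℕ.* s) h ⟩
  sumN (a ℕ.* s) s h + sumN (a ℕ.* s ℕ.+ s) (k ℕ.* s) h
    ≡⟨ cong (λ x → sumN (a ℕ.* s) s h + sumN x (k ℕ.* s) h) (ℕₚ.+-comm (a ℕ.* s) s) ⟩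
  sumN (a ℕ.* s) s h + sumN (suc a ℕ.* s) (k ℕ.* s) h
    ≡⟨ cong (sumN (a ℕ.* s) s h +_) (sumN-blocks s h (suc a) k) ⟩
  sumN (suc a) (suc k) (λ j → sumN ((j ∸ 1) ℕ.* s) s h) ∎
  where open ≡-Reasoning

⁺-nonneg : ∀ x → 0ℚ ≤ℚ x ⁺
⁺-nonneg x = ℚₚ.p≤q⊔p x 0ℚ

⁺-mono : ∀ {x y} → x ≤ℚ y → x ⁺ ≤ℚ y ⁺
⁺-mono = ℚₚ.⊔-monoˡ-≤ 0ℚ

⁺-subadditive : ∀ x y → (x + y) ⁺ ≤ℚ x ⁺ + y ⁺
⁺-subadditive x y = ℚₚ.⊔-lub (ℚₚ.+-mono-≤ (ℚₚ.p≤p⊔q x 0ℚ) (ℚₚ.p≤p⊔q y 0ℚ))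
                             (ℚₚ.+-mono-≤ (⁺-nonneg x) (⁺-nonneg y))

sumN-⁺ : ∀ s k g → sumN s k g ⁺ ≤ℚ sumN s k (λ i → g i ⁺)
sumN-⁺ s zero    g = ℚₚ.≤-reflexive (ℚₚ.⊔-idem 0ℚ)
sumN-⁺ s (suc k) g = ℚₚ.≤-trans (⁺-subadditive (g s) _) (ℚₚ.+-monoʳ-≤ (g s ⁺) (sumN-⁺ (suc s) k g))

*-distribˡ-⁺-nonNeg : ∀ c .{{_ : NonNegative c}} x y → c * (x - y) ⁺ ≡ (c * x - c * y) ⁺
*-distribˡ-⁺-nonNeg c x y = begin
  c * ((x - y) ⊔ 0ℚ)         ≡⟨ ℚₚ.*-distribˡ-⊔-nonNeg c (x - y) 0ℚ ⟩
  c * (x - y) ⊔ c * 0ℚ       ≡⟨ cong₂ _⊔_ (ℚₚ.*-distribˡ-+ c x (- y)) (ℚₚ.*-zeroʳ c) ⟩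
  (c * x + c * - y) ⊔ 0ℚ     ≡⟨ cong (λ z → (c * x + z) ⁺) (sym (ℚₚ.neg-distribʳ-* c y)) ⟩
  (c * x - c * y) ⁺          ∎
  where open ≡-Reasoning

p-q<p : ∀ p {q} → 0ℚ <ℚ q → p - q <ℚ p
p-q<p p 0<q = subst (p - _ <ℚ_) (ℚₚ.+-identityʳ p) (ℚₚ.+-monoʳ-< p (ℚₚ.neg-antimono-< 0<q))

m*n≤o⇒o<m*n+n⇒o/n≡m : ∀ {m n o} .{{_ : ℕ.NonZero n}} → m ℕ.* n ≤ o → o ℕ.< m ℕ.* n ℕ.+ n → o ℕ./ n ≡ m
m*n≤o⇒o<m*n+n⇒o/n≡m {m} {n} {o} mn≤o o<mn+n = ℕₚ.≤-antisym o/n≤m m≤o/n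
  where
  o/n≤m : o ℕ./ n ≤ m
  o/n≤m = ℕₚ.≤-pred (m<n*o⇒m/o<n (subst (o ℕ.<_) (ℕₚ.+-comm (m ℕ.* n) n) o<mn+n))
  m≤o/n : m ≤ o ℕ./ n
  m≤o/n = subst (_≤ o ℕ./ n) (m*n/n≡m m n) (/-monoˡ-≤ n mn≤o)

m*o+[n∸m]*o≡n*o : ∀ {a b} c → a ≤ b → a ℕ.* c ℕ.+ (b ∸ a) ℕ.* c ≡ b ℕ.* c
m*o+[n∸m]*o≡n*o {a} {b} c a≤b = trans (sym (ℕₚ.*-distribʳ-+ c a (b ∸ a))) (cong (ℕ._* c) (ℕₚ.m+[n∸m]≡n a≤b))

module Refinement (n-1 m-1 : ℕ) where

  n m : ℕ
  n = suc n-1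
  m = suc m-1

  -- n as a rational, written as a sum so that sumN-const produces it directly.
  nℚ : ℚ
  nℚ = sumN 0 n (λ _ → 1ℚ)

  instance
    nℚ-positive : Positive nℚ
    nℚ-positive = ℚₚ.pos+nonNeg⇒pos 1ℚ (sumN 1 n-1 (λ _ → 1ℚ))
      {{nonNegative (sumN-nonneg 1 n-1 (λ _ _ → ℚₚ.nonNegative⁻¹ 1ℚ))}}

  n⁻¹ : ℚ
  n⁻¹ = (1/ nℚ) {{ℚₚ.pos⇒nonZero nℚ}}

  instance
    n⁻¹-nonNeg : NonNegative n⁻¹
    n⁻¹-nonNeg = ℚₚ.pos⇒nonNeg n⁻¹ {{ℚₚ.1/pos⇒pos nℚ}}

  n⁻¹*-nonneg : ∀ {x} → 0ℚ ≤ℚ x → 0ℚ ≤ℚ n⁻¹ * x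
  n⁻¹*-nonneg {x} 0≤x = subst (_≤ℚ n⁻¹ * x) (ℚₚ.*-zeroʳ n⁻¹) (ℚₚ.*-monoˡ-≤-nonNeg n⁻¹ 0≤x)

  sumN-n-copies : ∀ s y → sumN s n (λ _ → n⁻¹ * y) ≡ y
  sumN-n-copies s y = begin
    sumN s n (λ _ → n⁻¹ * y) ≡⟨ sumN-const s 0 n (n⁻¹ * y) ⟩
    nℚ * (n⁻¹ * y)           ≡⟨ sym (ℚₚ.*-assoc nℚ n⁻¹ y) ⟩
    nℚ * n⁻¹ * y             ≡⟨ cong (_* y) (ℚₚ.*-inverseʳ nℚ {{ℚₚ.pos⇒nonZero nℚ}}) ⟩
    1ℚ * y                   ≡⟨ ℚₚ.*-identityˡ y ⟩
    y                        ∎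
    where open ≡-Reasoning

  level : ℕ → ℕ
  level p = suc (p ℕ./ n)

  level-∈ : ∀ {p} → p ℕ.< n ℕ.* m → level p ∈[ 1 ∶ m ]
  level-∈ {p} p<nm = s≤s z≤n , m<n*o⇒m/o<n (subst (p ℕ.<_) (ℕₚ.*-comm n m) p<nm)

  level-mono : ∀ {p p'} → p ≤ p' → level p ≤ level p'
  level-mono p≤p' = s≤s (/-monoˡ-≤ n p≤p')

  level-block : ∀ u {p} → InRange (u ℕ.* n) n p → level p ≡ suc u
  level-block u (un≤p , p<un+n) = cong suc (m*n≤o⇒o<m*n+n⇒o/n≡m un≤p p<un+n)

  spread : (ℕ → ℚ) → ℕ → ℚ
  spread g p = n⁻¹ * g (level p)

  regroup : (ℕ → ℚ) → ℕ → ℚ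
  regroup g j = sumN ((j ∸ 1) ℕ.* m) m (spread g)

  sumN-spread : ∀ g a k → sumN (a ℕ.* n) (k ℕ.* n) (spread g) ≡ sumN (suc a) k g
  sumN-spread g a k = trans (sumN-blocks n (spread g) a k) (sumN-cong (suc a) k block-sum)
    where
    block-sum : ∀ ℓ → InRange (suc a) k ℓ → sumN ((ℓ ∸ 1) ℕ.* n) n (spread g) ≡ g ℓ
    block-sum (suc u) _ =
      trans (sumN-cong (u ℕ.* n) n (λ p p∈ → cong (λ ℓ → n⁻¹ * g ℓ) (level-block u p∈)))
            (sumN-n-copies (u ℕ.* n) (g (suc u)))

  sumN-regroup : ∀ g a k → sumN (suc a) k (regroup g) ≡ sumN (a ℕ.* m) (k ℕ.* m) (spread g)
  sumN-regroup g a k = sym (sumN-blocks m (spread g) a k)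

  Σ-regroup : ∀ g → Σ[ 1 ∶ n ] (regroup g) ≡ Σ[ 1 ∶ m ] g
  Σ-regroup g = begin
    sumN 1 n (regroup g)          ≡⟨ sumN-regroup g 0 n ⟩
    sumN 0 (n ℕ.* m) (spread g)   ≡⟨ cong (λ k → sumN 0 k (spread g)) (ℕₚ.*-comm n m) ⟩
    sumN 0 (m ℕ.* n) (spread g)   ≡⟨ sumN-spread g 0 m ⟩
    sumN 1 m g                    ∎
    where open ≡-Reasoning

  atom : ℕ → ℕ → ℕ
  atom j t = (j ∸ 1) ℕ.* m ℕ.+ t

  regroup-atoms : ∀ g j → regroup g j ≡ sumN 0 m (λ t → spread g (atom j t))
  regroup-atoms g j = sumN-from0 ((j ∸ 1) ℕ.* m) m (spread g)

  atom<n*m : ∀ {j t} → j ∈[ 1 ∶ n ] → t ℕ.< m → atom j t ℕ.< n ℕ.* m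
  atom<n*m {suc i} {t} (_ , j≤n) t<m = begin-strict
    i ℕ.* m ℕ.+ t   <⟨ ℕₚ.+-monoʳ-< (i ℕ.* m) t<m ⟩
    i ℕ.* m ℕ.+ m   ≡⟨ ℕₚ.+-comm (i ℕ.* m) m ⟩
    suc i ℕ.* m     ≤⟨ ℕₚ.*-monoˡ-≤ m j≤n ⟩
    n ℕ.* m         ∎
    where open ℕₚ.≤-Reasoning

  regroup-nonneg : ∀ {g} → (∀ ℓ → ℓ ∈[ 1 ∶ m ] → 0ℚ ≤ℚ g ℓ) → ∀ j → j ∈[ 1 ∶ n ] → 0ℚ ≤ℚ regroup g j
  regroup-nonneg {g} g≥0 j j∈ = subst (0ℚ ≤ℚ_) (sym (regroup-atoms g j))
    (sumN-nonneg 0 m (λ t (_ , t<m) → n⁻¹*-nonneg (g≥0 _ (level-∈ (atom<n*m j∈ t<m)))))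

  module _ {f α δ} (F : FRFeasible m f α δ) where
    open FRFeasible F

    spread-mono : ∀ {p p'} → p ≤ p' → p' ℕ.< n ℕ.* m → spread α p ≤ℚ spread α p'
    spread-mono p≤p' p'<nm = ℚₚ.*-monoˡ-≤-nonNeg n⁻¹
      (mono _ _ (level-∈ (ℕₚ.≤-<-trans p≤p' p'<nm)) (level-∈ p'<nm) (level-mono p≤p'))

    regroup-mono : ∀ j j' → j ∈[ 1 ∶ n ] → j' ∈[ 1 ∶ n ] → j ≤ j' → regroup α j ≤ℚ regroup α j'
    regroup-mono j j' _ j'∈ j≤j' = subst₂ _≤ℚ_ (sym (regroup-atoms α j)) (sym (regroup-atoms α j'))
      (sumN-mono 0 m (λ t (_ , t<m) → spread-mono (atom-mono t) (atom<n*m j'∈ t<m)))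
      where
      atom-mono : ∀ t → atom j t ≤ atom j' t
      atom-mono t = ℕₚ.+-monoˡ-≤ t (ℕₚ.*-monoˡ-≤ m (ℕₚ.∸-monoˡ-≤ 1 j≤j'))

    spread-metric : ∀ {p p'} → p ℕ.< n ℕ.* m → p' ℕ.< n ℕ.* m →
                    spread α p' ≤ℚ spread α p + spread δ p + spread δ p'
    spread-metric {p} {p'} p<nm p'<nm = subst (spread α p' ≤ℚ_)
      (trans (ℚₚ.*-distribˡ-+ n⁻¹ _ _) (cong (_+ spread δ p') (ℚₚ.*-distribˡ-+ n⁻¹ _ _)))
      (ℚₚ.*-monoˡ-≤-nonNeg n⁻¹ (metric _ _ (level-∈ p<nm) (level-∈ p'<nm)))

    regroup-metric : ∀ j j' → j ∈[ 1 ∶ n ] → j' ∈[ 1 ∶ n ] →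
                     regroup α j' ≤ℚ regroup α j + regroup δ j + regroup δ j'
    regroup-metric j j' j∈ j'∈ = subst₂ _≤ℚ_ (sym (regroup-atoms α j')) sum-split
      (sumN-mono 0 m (λ t (_ , t<m) → spread-metric (atom<n*m j∈ t<m) (atom<n*m j'∈ t<m)))
      where
      A D D' : ℕ → ℚ
      A t = spread α (atom j t)
      D t = spread δ (atom j t)
      D' t = spread δ (atom j' t)
      sum-split : sumN 0 m (λ t → A t + D t + D' t) ≡ regroup α j + regroup δ j + regroup δ j'
      sum-split = begin
        sumN 0 m (λ t → A t + D t + D' t)            ≡⟨ sumN-+ 0 m (λ t → A t + D t) D' ⟩
        sumN 0 m (λ t → A t + D t) + sumN 0 m D'     ≡⟨ cong (_+ sumN 0 m D') (sumN-+ 0 m A D) ⟩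
        sumN 0 m A + sumN 0 m D + sumN 0 m D'
          ≡⟨ sym (cong₂ _+_ (cong₂ _+_ (regroup-atoms α j) (regroup-atoms δ j)) (regroup-atoms δ j')) ⟩
        regroup α j + regroup δ j + regroup δ j'     ∎
        where open ≡-Reasoning

    regroup-≤-last-atom : ∀ j s → j ∈[ 1 ∶ n ] → regroup α j ≤ℚ sumN s m (λ _ → spread α (atom j m-1))
    regroup-≤-last-atom j s j∈ = begin
      regroup α j                            ≡⟨ regroup-atoms α j ⟩
      sumN 0 m (λ t → spread α (atom j t))
        ≤⟨ sumN-mono 0 m (λ t (_ , t<m) → spread-mono (ℕₚ.+-monoʳ-≤ ((j ∸ 1) ℕ.* m) (ℕₚ.≤-pred t<m))
                                                      (atom<n*m j∈ ℕₚ.≤-refl)) ⟩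
      sumN 0 m (λ _ → top)                   ≡⟨ trans (sumN-const 0 0 m top) (sym (sumN-const s 0 m top)) ⟩
      sumN s m (λ _ → top)                   ∎
      where
      open ℚₚ.≤-Reasoning
      top : ℚ
      top = spread α (atom j m-1)

    regroup-gap⁺ : ∀ j j' → j ∈[ 1 ∶ n ] →
                   (regroup α j - regroup δ j') ⁺ ≤ℚ regroup (λ ℓ' → (α (level (atom j m-1)) - δ ℓ') ⁺) j'
    regroup-gap⁺ j j' j∈ = begin
      (regroup α j - regroup δ j') ⁺
        ≤⟨ ⁺-mono (ℚₚ.+-monoˡ-≤ (- regroup δ j') (regroup-≤-last-atom j B' j∈)) ⟩
      (sumN B' m (λ _ → top) - sumN B' m (spread δ)) ⁺
        ≡⟨ cong _⁺ (sym (sumN-- B' m (λ _ → top) (spread δ))) ⟩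
      sumN B' m (λ p → top - spread δ p) ⁺
        ≤⟨ sumN-⁺ B' m (λ p → top - spread δ p) ⟩
      sumN B' m (λ p → (top - spread δ p) ⁺)
        ≡⟨ sumN-cong B' m (λ p _ → sym (*-distribˡ-⁺-nonNeg n⁻¹ (α (level (atom j m-1))) (δ (level p)))) ⟩
      regroup (λ ℓ' → (α (level (atom j m-1)) - δ ℓ') ⁺) j' ∎
      where
      open ℚₚ.≤-Reasoning
      B' : ℕ
      B' = (j' ∸ 1) ℕ.* m
      top : ℚ
      top = spread α (atom j m-1)

    regroup-facility : ∀ j → j ∈[ 1 ∶ n ] → Σ[ suc j ∶ n ] (λ j' → (regroup α j - regroup δ j') ⁺) ≤ℚ f
    regroup-facility j@(suc i) j∈@(_ , j≤n) = begin
      sumN (suc j) (n ∸ j) (λ j' → (regroup α j - regroup δ j') ⁺)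
        ≤⟨ sumN-mono (suc j) (n ∸ j) (λ j' _ → regroup-gap⁺ j j' j∈) ⟩
      sumN (suc j) (n ∸ j) (regroup h)
        ≡⟨ sumN-regroup h j (n ∸ j) ⟩
      sumN (j ℕ.* m) ((n ∸ j) ℕ.* m) (spread h)
        ≤⟨ sumN-≤-extendˡ (λ p → n⁻¹*-nonneg (⁺-nonneg (α (suc q) - δ (level p)))) q*n≤j*m same-end ⟩
      sumN (q ℕ.* n) ((m ∸ q) ℕ.* n) (spread h)
        ≡⟨ sumN-spread h q (m ∸ q) ⟩
      sumN (suc q) (m ∸ q) h
        ≤⟨ facility (suc q) (level-∈ last<n*m) ⟩
      f ∎
      where
      open ℚₚ.≤-Reasoning
      last : ℕ
      last = atom j m-1
      last<n*m : last ℕ.< n ℕ.* m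
      last<n*m = atom<n*m j∈ ℕₚ.≤-refl
      -- client q + 1 owns the last atom of block j, and q * n is its first atom.
      q : ℕ
      q = last ℕ./ n
      h : ℕ → ℚ
      h ℓ' = (α (suc q) - δ ℓ') ⁺
      q*n≤j*m : q ℕ.* n ≤ j ℕ.* m
      q*n≤j*m = ℕₚ.≤-trans (m/n*n≤m last n)
        (ℕₚ.≤-trans (ℕₚ.+-monoʳ-≤ (i ℕ.* m) (ℕₚ.n≤1+n m-1)) (ℕₚ.≤-reflexive (ℕₚ.+-comm (i ℕ.* m) m)))
      same-end : j ℕ.* m ℕ.+ (n ∸ j) ℕ.* m ≡ q ℕ.* n ℕ.+ (m ∸ q) ℕ.* n
      same-end = trans (m*o+[n∸m]*o≡n*o m j≤n)
        (trans (ℕₚ.*-comm n m) (sym (m*o+[n∸m]*o≡n*o n (ℕₚ.<⇒≤ (proj₂ (level-∈ last<n*m))))))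

    regroup-feasible : SFRFeasible n f (regroup α) (regroup δ)
    regroup-feasible = record
      { f≥0      = f≥0
      ; α≥0      = regroup-nonneg α≥0
      ; δ≥0      = regroup-nonneg δ≥0
      ; mono     = regroup-mono
      ; metric   = λ j j' j∈ j'∈ → regroup-metric j j' (∈[2∶n]⇒∈[1∶n] j∈) (∈[2∶n]⇒∈[1∶n] j'∈)
      ; facility = regroup-facility
      ; budget   = subst (λ x → f + x ≤ℚ 1ℚ) (sym (Σ-regroup δ)) budget
      }
      where
      ∈[2∶n]⇒∈[1∶n] : ∀ {j} → j ∈[ 2 ∶ n ] → j ∈[ 1 ∶ n ]
      ∈[2∶n]⇒∈[1∶n] (2≤j , j≤n) = ℕₚ.≤-trans (ℕₚ.n≤1+n 1) 2≤j , j≤n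

lemma4p12 : ∀ (n m : ℕ) → 1 ≤ n → 1 ≤ m → ObjFR≤ObjSFR m n
lemma4p12 (suc n-1) (suc m-1) _ _ f α δ F ε 0<ε =
  f , regroup α , regroup δ , regroup-feasible F ,
  subst (Σ[ 1 ∶ m ] α - ε <ℚ_) (sym (Σ-regroup α)) (p-q<p (Σ[ 1 ∶ m ] α) 0<ε)
  where open Refinement n-1 m-1
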